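{- Let $G_i$ be a finite simple undirected graph with an orientation $\overline{G}_i$ in which there is no improving path between any two vertices. Delete an edge $\{u,v\}\in E(G_i)$ using the Delete procedure of StrongDynOpt, and suppose the call FindAndFlipPathRev$(u)$ finds an improving path $P$ (which is then flipped). Then the resulting orientation $\overline{G}_{i+1}$ contains no improving path.
   Context: An orientation of an undirected graph $G=(V,E)$ is a directed graph $\vec{G}=(V,E')$ such that for every $\{x,y\}\in E$ exactly one of $(x,y),(y,x)$ lies in $E'$; $\mathrm{odeg}(x,\vec{G})$ is the number of edges of $E'$ starting at $x$. A directed path $\langle v_0,\dots,v_k\rangle$ in $\vec{G}$ is an improving path if $\mathrm{odeg}(v_0,\vec{G})>\mathrm{odeg}(v_k,\vec{G})+1$. Flipping an edge $(x,y)$ means replacing it by $(y,x)$; out-degrees below always refer to the current orientation at the moment they are evaluated. FindAndFlipPathRev$(x)$ (a depth-first search, with a visited array that is all false at the start of each top-level call): if $x$ is visited, return false; for each $y$ with $(y,x)$ an edge, if $\mathrm{odeg}(y)>\mathrm{odeg}(x)+1$, flip $(y,x)$ and return true; mark $x$ visited; for each $y$ with $(y,x)$ an edge and $\mathrm{odeg}(y)=\mathrm{odeg}(x)+1$, if FindAndFlipPathRev$(y)$ returns true, flip $(y,x)$ and return true; return false. When the call returns true, the edges it flipped form (before flipping) a directed path of the orientation on which it was called; this is the path it is said to find. StrongDynOpt Delete$\{u,v\}$: label the endpoints so that the edge is currently oriented as $(u,v)$, remove it, and call FindAndFlipPathRev$(u)$. -}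

module Defs where

open import Data.Nat using (ℕ; zero; suc; _+_; _<_; _<ᵇ_; _≡ᵇ_)
open import Data.Bool using (Bool; true; false; if_then_else_; _∧_)
open import Data.Fin using (Fin; _≟_)
open import Data.List using (List; []; _∷_; map; allFin)
open import Data.Nat.ListAction using (sum)
open import Data.List.Relation.Unary.Linked using (Linked)
open import Data.List.Relation.Unary.Unique.Propositional using (Unique)
open import Data.Product using (_×_; _,_; Σ; ∃)
open import Relation.Binary.PropositionalEquality using (_≡_)
open import Relation.Nullary using (¬_)
open import Relation.Nullary.Decidable using (⌊_⌋)

-- A directed graph on vertex set Fin n, as an adjacency predicate:
-- D x y ≡ true  iff  (x , y) is a directed edge.
Orient : ℕ → Set
Orient n = Fin n → Fin n → Bool

-- D is an orientation of a finite simple undirected graph (namely of its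
-- underlying graph {{x,y} | D x y or D y x}): no loops, and at most one
-- direction per pair.
IsOrientation : ∀ {n} → Orient n → Set
IsOrientation {n} D =
  ((x : Fin n) → D x x ≡ false) × ((x y : Fin n) → D x y ≡ true → D y x ≡ false)

odeg : ∀ {n} → Orient n → Fin n → ℕ
odeg {n} D x = sum (map (λ y → if D x y then 1 else 0) (allFin n))

lastV : ∀ {n} → Fin n → List (Fin n) → Fin n
lastV v₀ []       = v₀
lastV v₀ (w ∷ ws) = lastV w ws

IsDirPath : ∀ {n} → Orient n → Fin n → List (Fin n) → Set
IsDirPath D v₀ vs = Linked (λ a b → D a b ≡ true) (v₀ ∷ vs) × Unique (v₀ ∷ vs)

IsImprovingPath : ∀ {n} → Orient n → Fin n → List (Fin n) → Set
IsImprovingPath D v₀ vs =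
  IsDirPath D v₀ vs × (suc (odeg D (lastV v₀ vs)) < odeg D v₀)

NoImprovingPath : ∀ {n} → Orient n → Set
NoImprovingPath {n} D = (v₀ : Fin n) (vs : List (Fin n)) → ¬ IsImprovingPath D v₀ vs

isPair : ∀ {n} → Fin n → Fin n → Fin n → Fin n → Bool
isPair a b u v = ⌊ a ≟ u ⌋ ∧ ⌊ b ≟ v ⌋

removeEdge : ∀ {n} → Orient n → Fin n → Fin n → Orient n
removeEdge D u v a b = if isPair a b u v then false else D a b

flipEdge : ∀ {n} → Orient n → Fin n → Fin n → Orient n
flipEdge D y x a b =
  if isPair a b y x then false else (if isPair a b x y then true else D a b)

Visited : ℕ → Set
Visited n = Fin n → Bool

mark : ∀ {n} → Visited n → Fin n → Visited n
mark vis x z = if ⌊ z ≟ x ⌋ then true else vis z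

Res : ℕ → Set
Res n = Bool × Orient n × Visited n

-- FindAndFlipPathRev as a state-passing recursive procedure.
-- `ord` is the order in which the loops "for each y" enumerate vertices.
-- The ℕ argument is fuel bounding recursion depth (fuel
-- suc n is never exhausted, as recursive calls mark distinct vertices).
mutual
  ffp : ∀ {n} → ℕ → List (Fin n) → Orient n → Visited n → Fin n → Res n
  ffp zero    ord D vis x = false , D , vis
  ffp (suc f) ord D vis x =
    if vis x then (false , D , vis) else loop1 f ord D vis x ord

  loop1 : ∀ {n} → ℕ → List (Fin n) → Orient n → Visited n → Fin n → List (Fin n) → Res n
  loop1 f ord D vis x [] = loop2 f ord D (mark vis x) x ord
  loop1 f ord D vis x (y ∷ ys) =
    if D y x ∧ (suc (odeg D x) <ᵇ odeg D y)
    then (true , flipEdge D y x , vis)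
    else loop1 f ord D vis x ys

  loop2 : ∀ {n} → ℕ → List (Fin n) → Orient n → Visited n → Fin n → List (Fin n) → Res n
  loop2 f ord D vis x [] = false , D , vis
  loop2 f ord D vis x (y ∷ ys) =
    if D y x ∧ (odeg D y ≡ᵇ suc (odeg D x))
    then after (ffp f ord D vis y)
    else loop2 f ord D vis x ys
    where
      after : _ → _
      after (true  , D′ , vis′) = true , flipEdge D′ y x , vis′
      after (false , D′ , vis′) = loop2 f ord D′ vis′ x ys

findAndFlipPathRev : ∀ {n} → List (Fin n) → Orient n → Fin n → Res n
findAndFlipPathRev {n} ord D x = ffp (suc n) ord D (λ _ → false) x

{-# OPTIONS --safe #-}
module Submission where

-- Deleting (u, v) lowers only the out-degree of u, so in D₁ = D − (u, v)
-- every edge y → x with x ≠ u still has odeg y ≤ odeg x + 1. The search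
-- starts at u and marks it visited, so every recursive call is at some x ≠ u
-- and fails without flipping anything: a successful call flips one edge
-- (y, u) with odeg y ≥ odeg u + 2 in D₁, i.e. odeg y = odeg u + 1 in D.
-- After the flip both u and y have the out-degree u had in D, and every other
-- vertex keeps its out-degree from D. A walk in the new orientation is a walk
-- in D, or goes a ⇝ u → y ⇝ b through the flipped edge with a ⇝ u and y ⇝ b
-- walks in D; since D has no improving walk, both cases bound the degree drop.

open import Defs
open import Data.Bool using (Bool; true; false; if_then_else_; _∧_; T)
open import Data.Empty using (⊥-elim)
open import Data.Fin using (Fin; zero; suc; _≟_)
open import Data.Fin.Properties using (suc-injective)
open import Data.List using (List; []; _∷_; allFin; tabulate)
open import Data.List.Properties using (map-tabulate; tabulate-cong)
open import Data.List.Relation.Binary.Permutation.Propositional using (_↭_)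
open import Data.List.Relation.Unary.All using (All; []; _∷_)
open import Data.List.Relation.Unary.AllPairs using ([]; _∷_)
open import Data.List.Relation.Unary.Linked using (Linked; [-]; _∷_)
open import Data.Nat using (ℕ; zero; suc; _+_; _≤_; _<_; _<ᵇ_; _≡ᵇ_; z≤n; s≤s; s≤s⁻¹)
open import Data.Nat.ListAction using (sum)
open import Data.Nat.Properties
  using (≤-refl; ≤-reflexive; ≤-trans; ≤-antisym; +-mono-≤; +-suc; n≤1+n; <⇒≱; ≮⇒≥; <ᵇ⇒<; module ≤-Reasoning)
  renaming (suc-injective to ℕ-suc-injective)
open import Data.Product using (Σ; ∃; _×_; _,_; proj₁; proj₂)
open import Data.Sum using (_⊎_; inj₁; inj₂)
open import Data.Unit using (tt)
open import Function using (_∘_; id)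
open import Relation.Binary.Core using (Rel)
open import Relation.Binary.Construct.Closure.ReflexiveTransitive using (Star; ε; _◅_; _◅◅_)
open import Relation.Binary.PropositionalEquality
open import Relation.Nullary using (Dec; yes; no)
open import Relation.Nullary.Decidable using (decidable-stable)

private
  variable
    n : ℕ

indicator : Bool → ℕ
indicator b = if b then 1 else 0

count : (Fin n → Bool) → ℕ
count r = sum (tabulate (indicator ∘ r))

indicator-mono : {b b′ : Bool} → (b′ ≡ true → b ≡ true) → indicator b′ ≤ indicator b
indicator-mono {b′ = false} _    = z≤n
indicator-mono {b′ = true}  b′⇒b rewrite b′⇒b refl = ≤-refl

count-mono : {r r′ : Fin n → Bool} → (∀ z → r′ z ≡ true → r z ≡ true) → count r′ ≤ count r
count-mono {zero}  _     = z≤n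
count-mono {suc n} r′⊆r = +-mono-≤ (indicator-mono (r′⊆r zero)) (count-mono (r′⊆r ∘ suc))

count-cong : {r r′ : Fin n → Bool} → (∀ z → r z ≡ r′ z) → count r ≡ count r′
count-cong r≗r′ = cong sum (tabulate-cong (cong indicator ∘ r≗r′))

count-toggle : {r r′ : Fin n → Bool} (w : Fin n) → r w ≡ true → r′ w ≡ false →
  (∀ z → z ≢ w → r z ≡ r′ z) → count r ≡ suc (count r′)
count-toggle {suc n} zero rw r′w same rewrite rw | r′w =
  cong suc (count-cong (λ z → same (suc z) λ ()))
count-toggle {suc n} (suc w) rw r′w same =
  trans (cong₂ _+_ (cong indicator (same zero λ ()))
                   (count-toggle w rw r′w (λ z z≢w → same (suc z) (z≢w ∘ suc-injective))))
        (+-suc _ _)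

odeg≡count : (D : Orient n) (x : Fin n) → odeg D x ≡ count (D x)
odeg≡count D x = cong sum (map-tabulate id (indicator ∘ D x))

odeg-mono : (D D′ : Orient n) {x : Fin n} → (∀ z → D′ x z ≡ true → D x z ≡ true) →
  odeg D′ x ≤ odeg D x
odeg-mono D D′ {x} D′⊆D =
  subst₂ _≤_ (sym (odeg≡count D′ x)) (sym (odeg≡count D x)) (count-mono D′⊆D)

odeg-cong : (D D′ : Orient n) {x : Fin n} → (∀ z → D x z ≡ D′ x z) → odeg D x ≡ odeg D′ x
odeg-cong D D′ {x} same =
  trans (odeg≡count D x) (trans (count-cong same) (sym (odeg≡count D′ x)))

odeg-toggle : (D D′ : Orient n) {x w : Fin n} → D x w ≡ true → D′ x w ≡ false →
  (∀ z → z ≢ w → D x z ≡ D′ x z) → odeg D x ≡ suc (odeg D′ x)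
odeg-toggle D D′ {x} {w} Dxw D′xw same =
  trans (odeg≡count D x) (trans (count-toggle w Dxw D′xw same) (cong suc (sym (odeg≡count D′ x))))

isPair-refl : (a b : Fin n) → isPair a b a b ≡ true
isPair-refl a b with a ≟ a | b ≟ b
... | yes _   | yes _   = refl
... | no a≢a  | _       = ⊥-elim (a≢a refl)
... | yes _   | no b≢b  = ⊥-elim (b≢b refl)

module _ {a b u v : Fin n} where

  isPair-≢ : (a , b) ≢ (u , v) → isPair a b u v ≡ false
  isPair-≢ ab≢uv with a ≟ u | b ≟ v
  ... | no _       | _        = refl
  ... | yes _      | no _     = refl
  ... | yes refl   | yes refl = ⊥-elim (ab≢uv refl)

  isPair⇒≡ : isPair a b u v ≡ true → a ≡ u × b ≡ v
  isPair⇒≡ _ with a ≟ u | b ≟ v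
  isPair⇒≡ _  | yes a≡u | yes b≡v = a≡u , b≡v
  isPair⇒≡ () | no _    | _
  isPair⇒≡ () | yes _   | no _

module RemoveEdge (D : Orient n) (u v : Fin n) where

  removeEdge-⊆ : ∀ {a b} → removeEdge D u v a b ≡ true → D a b ≡ true
  removeEdge-⊆ {a} {b} with isPair a b u v
  ... | true  = λ ()
  ... | false = id

  removeEdge-false : ∀ {a b} → D a b ≡ false → removeEdge D u v a b ≡ false
  removeEdge-false {a} {b} with isPair a b u v
  ... | true  = λ _ → refl
  ... | false = id

  removeEdge-≢ : ∀ a b → (a , b) ≢ (u , v) → removeEdge D u v a b ≡ D a b
  removeEdge-≢ a b ab≢uv rewrite isPair-≢ ab≢uv = refl

  removeEdge-removed : removeEdge D u v u v ≡ false
  removeEdge-removed rewrite isPair-refl u v = refl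

  odeg-removeEdge-≤ : ∀ a → odeg (removeEdge D u v) a ≤ odeg D a
  odeg-removeEdge-≤ a = odeg-mono D (removeEdge D u v) (λ _ → removeEdge-⊆)

  odeg-removeEdge-≢ : ∀ {a} → a ≢ u → odeg (removeEdge D u v) a ≡ odeg D a
  odeg-removeEdge-≢ {a} a≢u =
    odeg-cong (removeEdge D u v) D (λ z → removeEdge-≢ a z (a≢u ∘ cong proj₁))

  odeg-removeEdge-tail : D u v ≡ true → odeg D u ≡ suc (odeg (removeEdge D u v) u)
  odeg-removeEdge-tail uv = odeg-toggle D (removeEdge D u v) uv removeEdge-removed
    (λ z z≢v → sym (removeEdge-≢ u z (z≢v ∘ cong proj₂)))

module FlipEdge (D : Orient n) (y x : Fin n) where

  flipEdge-≢ : ∀ a b → (a , b) ≢ (y , x) → (a , b) ≢ (x , y) → flipEdge D y x a b ≡ D a b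
  flipEdge-≢ a b ab≢yx ab≢xy rewrite isPair-≢ ab≢yx | isPair-≢ ab≢xy = refl

  flipEdge-edge : ∀ {a b} → flipEdge D y x a b ≡ true → (a ≡ x × b ≡ y) ⊎ D a b ≡ true
  flipEdge-edge {a} {b} with isPair a b y x | isPair a b x y in ab≡xy
  ... | true  | _     = λ ()
  ... | false | true  = λ _ → inj₁ (isPair⇒≡ ab≡xy)
  ... | false | false = inj₂

  odeg-flipEdge-tail : y ≢ x → D y x ≡ true → odeg D y ≡ suc (odeg (flipEdge D y x) y)
  odeg-flipEdge-tail y≢x yx = odeg-toggle D (flipEdge D y x) yx removed
    (λ z z≢x → sym (flipEdge-≢ y z (z≢x ∘ cong proj₂) (y≢x ∘ cong proj₁)))
    where
      removed : flipEdge D y x y x ≡ false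
      removed rewrite isPair-refl y x = refl

  odeg-flipEdge-head : x ≢ y → D x y ≡ false → odeg (flipEdge D y x) x ≡ suc (odeg D x)
  odeg-flipEdge-head x≢y xy = odeg-toggle (flipEdge D y x) D added xy
    (λ z z≢y → flipEdge-≢ x z (x≢y ∘ cong proj₁) (z≢y ∘ cong proj₂))
    where
      added : flipEdge D y x x y ≡ true
      added rewrite isPair-≢ {a = x} {y} {y} {x} (x≢y ∘ cong proj₁) | isPair-refl x y = refl

  odeg-flipEdge-≢ : ∀ {a} → a ≢ y → a ≢ x → odeg (flipEdge D y x) a ≡ odeg D a
  odeg-flipEdge-≢ {a} a≢y a≢x =
    odeg-cong (flipEdge D y x) D (λ z → flipEdge-≢ a z (a≢y ∘ cong proj₁) (a≢x ∘ cong proj₁))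

Edge : Orient n → Fin n → Fin n → Set
Edge D a b = D a b ≡ true

Walk : Orient n → Fin n → Fin n → Set
Walk D = Star (Edge D)

DirPathBetween : Orient n → Fin n → Fin n → Set
DirPathBetween {n} D a c = Σ (List (Fin n)) λ ws → IsDirPath D a ws × lastV a ws ≡ c

linked⇒star : ∀ {ℓ} {R : Rel (Fin n) ℓ} {a vs} → Linked R (a ∷ vs) → Star R a (lastV a vs)
linked⇒star {vs = []}    _        = ε
linked⇒star {vs = _ ∷ _} (r ∷ rs) = r ◅ linked⇒star rs

module _ {D : Orient n} where

  dirPath-suffixFrom : ∀ a {b ws} → IsDirPath D b ws →
    DirPathBetween D a (lastV b ws) ⊎ All (a ≢_) (b ∷ ws)
  dirPath-suffixFrom a {b} {ws} p with a ≟ b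
  ... | yes refl = inj₁ (ws , p , refl)
  dirPath-suffixFrom a {b} {[]}     _                | no a≢b = inj₂ (a≢b ∷ [])
  dirPath-suffixFrom a {b} {c ∷ cs} (_ ∷ lk , _ ∷ un) | no a≢b with dirPath-suffixFrom a (lk , un)
  ... | inj₁ q   = inj₁ q
  ... | inj₂ a∉ = inj₂ (a≢b ∷ a∉)

  walk⇒dirPath : ∀ {a c} → Walk D a c → DirPathBetween D a c
  walk⇒dirPath ε = [] , ([-] , [] ∷ []) , refl
  walk⇒dirPath {a} (e ◅ w) with walk⇒dirPath w
  ... | ws , p@(lk , un) , refl with dirPath-suffixFrom a p
  ...   | inj₁ q   = q
  ...   | inj₂ a∉ = _ ∷ ws , (e ∷ lk , a∉ ∷ un) , refl

  noImprovingWalk : NoImprovingPath D → ∀ {a c} → Walk D a c → odeg D a ≤ suc (odeg D c)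
  noImprovingWalk nip {a} w with walk⇒dirPath w
  ... | ws , p , refl = ≮⇒≥ (λ lt → nip a ws (p , lt))

ImprovingEdgesEndAt : Orient n → Fin n → Set
ImprovingEdgesEndAt D u = ∀ {x y} → D y x ≡ true → suc (odeg D x) < odeg D y → x ≡ u

removeEdge-improvingEdgesEndAt : {D : Orient n} → NoImprovingPath D →
  ∀ u v → ImprovingEdgesEndAt (removeEdge D u v) u
removeEdge-improvingEdgesEndAt {D = D} nip u v {x} {y} yx lt =
  decidable-stable (x ≟ u) λ x≢u → <⇒≱ lt (begin
    odeg (removeEdge D u v) y        ≤⟨ odeg-removeEdge-≤ y ⟩
    odeg D y                         ≤⟨ noImprovingWalk nip (removeEdge-⊆ yx ◅ ε) ⟩
    suc (odeg D x)                   ≡⟨ cong suc (sym (odeg-removeEdge-≢ x≢u)) ⟩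
    suc (odeg (removeEdge D u v) x)  ∎)
  where
    open ≤-Reasoning
    open RemoveEdge D u v

ImprovingFlipInto : Orient n → Fin n → Orient n → Set
ImprovingFlipInto D u D′ = ∃ λ y → D y u ≡ true × suc (odeg D u) < odeg D y × D′ ≡ flipEdge D y u

if-elim : ∀ {A : Set} (P : A → Set) c {a b} → P a → P b → P (if c then a else b)
if-elim P true  pa _  = pa
if-elim P false _  pb = pb

module _ (ord : List (Fin n)) {D : Orient n} {u : Fin n} (into-u : ImprovingEdgesEndAt D u) where

  Fails : Res n → Set
  Fails r = ∃ λ vis → r ≡ (false , D , vis) × vis u ≡ true

  no-improving-edge-into : ∀ {x} → x ≢ u → ∀ y → (D y x ∧ (suc (odeg D x) <ᵇ odeg D y)) ≡ false
  no-improving-edge-into {x} x≢u y with D y x in yx | suc (odeg D x) <ᵇ odeg D y in lt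
  ... | false | _     = refl
  ... | true  | false = refl
  ... | true  | true  = ⊥-elim (x≢u (into-u yx (<ᵇ⇒< _ _ (subst T (sym lt) tt))))

  mark-keeps : ∀ (vis : Visited n) x → vis u ≡ true → mark vis x u ≡ true
  mark-keeps vis x vu with u ≟ x
  ... | yes _ = refl
  ... | no _  = vu

  mutual
    ffp-fails : ∀ f vis x → vis u ≡ true → Fails (ffp f ord D vis x)
    ffp-fails zero    vis x vu = vis , refl , vu
    ffp-fails (suc f) vis x vu with vis x in vx
    ... | true  = vis , refl , vu
    ... | false = loop1-fails f vis x x≢u vu ord
      where
        x≢u : x ≢ u
        x≢u refl with () ← trans (sym vx) vu

    loop1-fails : ∀ f vis x → x ≢ u → vis u ≡ true → ∀ ys → Fails (loop1 f ord D vis x ys)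
    loop1-fails f vis x x≢u vu []       = loop2-fails f (mark vis x) x (mark-keeps vis x vu) ord
    loop1-fails f vis x x≢u vu (y ∷ ys) rewrite no-improving-edge-into x≢u y =
      loop1-fails f vis x x≢u vu ys

    loop2-fails : ∀ f vis x → vis u ≡ true → ∀ ys → Fails (loop2 f ord D vis x ys)
    loop2-fails f vis x vu []       = vis , refl , vu
    loop2-fails f vis x vu (y ∷ ys) with ffp f ord D vis y | ffp-fails f vis y vu
    ... | ._ | vis′ , refl , vu′ =
      if-elim Fails (D y x ∧ (odeg D y ≡ᵇ suc (odeg D x)))
        (loop2-fails f vis′ x vu′ ys) (loop2-fails f vis x vu ys)

  mark-self : ∀ (vis : Visited n) → mark vis u u ≡ true
  mark-self vis with u ≟ u
  ... | yes _   = refl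
  ... | no u≢u  = ⊥-elim (u≢u refl)

  loop1-succeeds : ∀ f vis ys → proj₁ (loop1 f ord D vis u ys) ≡ true →
    ImprovingFlipInto D u (proj₁ (proj₂ (loop1 f ord D vis u ys)))
  loop1-succeeds f vis [] succeeded
    with loop2 f ord D (mark vis u) u ord | loop2-fails f (mark vis u) u (mark-self vis) ord
  loop1-succeeds f vis [] () | ._ | _ , refl , _
  loop1-succeeds f vis (y ∷ ys) succeeded with D y u in yu | suc (odeg D u) <ᵇ odeg D y in lt
  ... | true  | true  = y , yu , <ᵇ⇒< _ _ (subst T (sym lt) tt) , refl
  ... | true  | false = loop1-succeeds f vis ys succeeded
  ... | false | _     = loop1-succeeds f vis ys succeeded

  findAndFlipPathRev-flipsImprovingEdge : proj₁ (findAndFlipPathRev ord D u) ≡ true →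
    ImprovingFlipInto D u (proj₁ (proj₂ (findAndFlipPathRev ord D u)))
  findAndFlipPathRev-flipsImprovingEdge = loop1-succeeds n (λ _ → false) ord

module _ {a ℓ₁ ℓ₂} {A : Set a} {R : Rel A ℓ₁} {S : Rel A ℓ₂} {x y : A} where

  star-avoids⊎crosses : (∀ {a b} → R a b → (a ≡ x × b ≡ y) ⊎ S a b) →
    ∀ {a b} → Star R a b → Star S a b ⊎ (Star S a x × Star S y b)
  star-avoids⊎crosses classify ε = inj₁ ε
  star-avoids⊎crosses classify (r ◅ rs) with classify r | star-avoids⊎crosses classify rs
  ... | inj₁ (refl , refl) | inj₁ y⇝b       = inj₂ (ε , y⇝b)
  ... | inj₁ (refl , refl) | inj₂ (_ , y⇝b) = inj₂ (ε , y⇝b)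
  ... | inj₂ s             | inj₁ c⇝b       = inj₁ (s ◅ c⇝b)
  ... | inj₂ s             | inj₂ (c⇝x , y⇝b) = inj₂ (s ◅ c⇝x , y⇝b)

module AfterDeletionAndFlip
  {D : Orient n} (orientation : IsOrientation D) (nip : NoImprovingPath D)
  {u v : Fin n} (uv : D u v ≡ true)
  {y : Fin n} (yu₁ : removeEdge D u v y u ≡ true)
  (improving : suc (odeg (removeEdge D u v) u) < odeg (removeEdge D u v) y)
  where

  D₁ D₂ : Orient n
  D₁ = removeEdge D u v
  D₂ = flipEdge D₁ y u

  open RemoveEdge D u v
  open FlipEdge D₁ y u

  yu : D y u ≡ true
  yu = removeEdge-⊆ yu₁

  y≢u : y ≢ u
  y≢u refl with () ← trans (sym (proj₁ orientation y)) yu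

  u≢y : u ≢ y
  u≢y = y≢u ∘ sym

  odeg-u : odeg D u ≡ suc (odeg D₁ u)
  odeg-u = odeg-removeEdge-tail uv

  odeg-y : odeg D y ≡ suc (odeg D u)
  odeg-y = ≤-antisym (noImprovingWalk nip (yu ◅ ε))
    (subst₂ _≤_ (cong suc (sym odeg-u)) (odeg-removeEdge-≢ y≢u) improving)

  odeg₂-u : odeg D₂ u ≡ odeg D u
  odeg₂-u = begin
    odeg D₂ u          ≡⟨ odeg-flipEdge-head u≢y (removeEdge-false (proj₂ orientation y u yu)) ⟩
    suc (odeg D₁ u)    ≡⟨ sym odeg-u ⟩
    odeg D u           ∎
    where open ≡-Reasoning

  odeg₂-y : odeg D₂ y ≡ odeg D u
  odeg₂-y = ℕ-suc-injective (begin
    suc (odeg D₂ y)    ≡⟨ sym (odeg-flipEdge-tail y≢u yu₁) ⟩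
    odeg D₁ y          ≡⟨ odeg-removeEdge-≢ y≢u ⟩
    odeg D y           ≡⟨ odeg-y ⟩
    suc (odeg D u)     ∎)
    where open ≡-Reasoning

  odeg₂-other : ∀ {a} → a ≢ u → a ≢ y → odeg D₂ a ≡ odeg D a
  odeg₂-other a≢u a≢y = trans (odeg-flipEdge-≢ a≢y a≢u) (odeg-removeEdge-≢ a≢u)

  odeg₂≤odeg : ∀ a → odeg D₂ a ≤ odeg D a
  odeg₂≤odeg a = cases (a ≟ u) (a ≟ y)
    where
      cases : Dec (a ≡ u) → Dec (a ≡ y) → odeg D₂ a ≤ odeg D a
      cases (yes refl) _          = ≤-reflexive odeg₂-u
      cases (no _)     (yes refl) = subst₂ _≤_ (sym odeg₂-y) (sym odeg-y) (n≤1+n _)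
      cases (no a≢u)   (no a≢y)   = ≤-reflexive (odeg₂-other a≢u a≢y)

  odeg≤odeg₂ : ∀ {a} → a ≢ y → odeg D a ≤ odeg D₂ a
  odeg≤odeg₂ {a} a≢y = cases (a ≟ u)
    where
      cases : Dec (a ≡ u) → odeg D a ≤ odeg D₂ a
      cases (yes refl) = ≤-reflexive (sym odeg₂-u)
      cases (no a≢u)   = ≤-reflexive (sym (odeg₂-other a≢u a≢y))

  odeg-u≤odeg₂ : ∀ {b} → Walk D y b → odeg D u ≤ odeg D₂ b
  odeg-u≤odeg₂ {b} y⇝b = cases (b ≟ y)
    where
      cases : Dec (b ≡ y) → odeg D u ≤ odeg D₂ b
      cases (yes refl) = ≤-reflexive (sym odeg₂-y)
      cases (no b≢y)   = ≤-trans
        (s≤s⁻¹ (subst (_≤ suc (odeg D b)) odeg-y (noImprovingWalk nip y⇝b))) (odeg≤odeg₂ b≢y)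

  edge₂ : ∀ {a b} → Edge D₂ a b → (a ≡ u × b ≡ y) ⊎ Edge D a b
  edge₂ e with flipEdge-edge e
  ... | inj₁ ab≡uy = inj₁ ab≡uy
  ... | inj₂ e₁    = inj₂ (removeEdge-⊆ e₁)

  through-u : ∀ {a b} → Walk D a u → Walk D y b → odeg D₂ a ≤ suc (odeg D₂ b)
  through-u {a} {b} a⇝u y⇝b = begin
    odeg D₂ a          ≤⟨ odeg₂≤odeg a ⟩
    odeg D a           ≤⟨ noImprovingWalk nip a⇝u ⟩
    suc (odeg D u)     ≤⟨ s≤s (odeg-u≤odeg₂ y⇝b) ⟩
    suc (odeg D₂ b)    ∎
    where open ≤-Reasoning

  noImprovingWalk₂ : ∀ {a b} → Walk D₂ a b → odeg D₂ a ≤ suc (odeg D₂ b)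
  noImprovingWalk₂ {a} {b} w with star-avoids⊎crosses edge₂ w
  ... | inj₂ (a⇝u , y⇝b) = through-u a⇝u y⇝b
  ... | inj₁ a⇝b = cases (b ≟ y)
    where
      cases : Dec (b ≡ y) → odeg D₂ a ≤ suc (odeg D₂ b)
      cases (yes refl) = through-u (a⇝b ◅◅ yu ◅ ε) ε
      cases (no b≢y)   = begin
        odeg D₂ a          ≤⟨ odeg₂≤odeg a ⟩
        odeg D a           ≤⟨ noImprovingWalk nip a⇝b ⟩
        suc (odeg D b)     ≤⟨ s≤s (odeg≤odeg₂ b≢y) ⟩
        suc (odeg D₂ b)    ∎
        where open ≤-Reasoning

  noImprovingPath₂ : NoImprovingPath D₂
  noImprovingPath₂ a vs ((linked , _) , lt) = <⇒≱ lt (noImprovingWalk₂ (linked⇒star linked))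

lemma3p6 : ∀ {n} (ord : List (Fin n)) → ord ↭ allFin n →
    (D : Orient n) → IsOrientation D → NoImprovingPath D →
    (u v : Fin n) → D u v ≡ true →
    proj₁ (findAndFlipPathRev ord (removeEdge D u v) u) ≡ true →
    NoImprovingPath (proj₁ (proj₂ (findAndFlipPathRev ord (removeEdge D u v) u)))
-- The argument works for every enumeration order.
lemma3p6 ord _ D orientation nip u v uv succeeded
  with findAndFlipPathRev-flipsImprovingEdge ord (removeEdge-improvingEdgesEndAt nip u v) succeeded
... | y , yu , improving , result =
  subst NoImprovingPath (sym result) (AfterDeletionAndFlip.noImprovingPath₂ orientation nip uv yu improving)
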